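{- Let $A=\langle\mathcal D,\Sigma,\vec x,Q,\iota,F,\Delta\rangle$ be a data automaton and $R\subseteq Q\times\mathcal D^{\vec x}\times Q$ a data simulation for $A$. Then for every $(q,\nu,q')\in R$ we have $\mathcal L_{(q,\nu)}(A)\subseteq\mathcal L_{(q',\nu)}(A)$.
   Context: $\mathcal{D}$ is a data domain with first-order theory $\mathrm{Th}(\mathcal D)$. A data automaton $\langle\mathcal D,\Sigma,\vec x,Q,\iota,F,\Delta\rangle$ has finite alphabet $\Sigma$ containing a padding symbol $\diamond$, finite variables $\vec x$, finite states $Q$, initial $\iota$, final $F\subseteq Q$, and rules $q\xrightarrow{\sigma,\phi(\vec x,\vec x')}q'$ with $\phi\in\mathrm{Th}(\mathcal D)$. We write $(q,\nu)\xrightarrow{\sigma}_A(q',\nu')$ if some rule $q\xrightarrow{\sigma,\phi}q'$ satisfies $(\nu,\nu')\models\phi$. A trace is $(\nu_0,\sigma_0),\dots,(\nu_{n-1},\sigma_{n-1}),(\nu_n,\diamond)$ with $\nu_i\in\mathcal D^{\vec x}$; a run over it from $(q_0,\nu_0)$ is $(q_0,\nu_0)\xrightarrow{\sigma_0}_A(q_1,\nu_1)\cdots\xrightarrow{\sigma_{n-1}}_A(q_n,\nu_n)$, accepting if $q_n\in F$. The residual language $\mathcal L_{(q,\nu)}(A)$ is the set of traces with first valuation $\nu$ that have an accepting run starting in $(q,\nu)$. A relation $R\subseteq Q\times\mathcal D^{\vec x}\times Q$ is a data simulation for $A$ if for all $(q,\nu,q')\in R$: (1) $q\in F$ implies $q'\in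 F$, and (2) for all $\sigma\in\Sigma$ and $(r,\nu')$ with $(q,\nu)\xrightarrow{\sigma}_A(r,\nu')$ there is $r'\in Q$ with $(q',\nu)\xrightarrow{\sigma}_A(r',\nu')$ and $(r,\nu',r')\in R$. -}

module Defs where

open import Level using (Level; _⊔_; suc)
open import Data.Nat using (ℕ)
open import Data.Fin using (Fin)
open import Data.List using (List; []; _∷_)
open import Data.Product using (_×_; _,_; Σ; ∃)
open import Relation.Unary using (Pred)

-- A data automaton over data domain D (a type; the first-order theory is
-- represented semantically: a transition guard φ(x⃗, x⃗') is identified with the
-- relation it defines on pairs of valuations).
record DataAutomaton {d} (D : Set d) (ℓ : Level) : Set (d ⊔ suc ℓ) where
  field
    nΣ nx nQ : ℕ
    ⋄        : Fin nΣ
    ι        : Fin nQ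
    F        : Pred (Fin nQ) ℓ
    Δ        : List (Fin nQ × Fin nΣ × ((Fin nx → D) → (Fin nx → D) → Set ℓ) × Fin nQ)

module _ {d ℓ} {D : Set d} (A : DataAutomaton D ℓ) where
  open DataAutomaton A

  Σ' : Set
  Σ' = Fin nΣ

  Q : Set
  Q = Fin nQ

  Val : Set d
  Val = Fin nx → D

  open import Data.List.Membership.Propositional using (_∈_)

  Step : Q → Val → Σ' → Q → Val → Set (d ⊔ suc ℓ)
  Step q ν σ q' ν' =
    Σ (Val → Val → Set ℓ) λ φ → ((q , σ , φ , q') ∈ Δ) × φ ν ν'

  -- A trace (ν₀,σ₀),…,(ν_{n-1},σ_{n-1}),(ν_n,⋄): the list of non-final
  -- pairs together with the final valuation ν_n (whose letter is ⋄).
  record Trace : Set d where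
    constructor trace
    field
      steps : List (Val × Σ')
      last  : Val

  firstVal : Trace → Val
  firstVal (trace [] ν) = ν
  firstVal (trace ((ν , _) ∷ _) _) = ν

  data AccRun : Q → List (Val × Σ') → Val → Set (d ⊔ suc ℓ) where
    done : ∀ {q ν} → F q → AccRun q [] ν
    step : ∀ {q ν σ q₁ rest νn} →
           Step q ν σ q₁ (firstVal (trace rest νn)) →
           AccRun q₁ rest νn →
           AccRun q ((ν , σ) ∷ rest) νn

  L : Q → Val → Pred Trace (d ⊔ suc ℓ)
  L q ν w = (firstVal w ≡ ν) × AccRun q (Trace.steps w) (Trace.last w)
    where open import Relation.Binary.PropositionalEquality using (_≡_)

  IsDataSimulation : ∀ {r} → (Q → Val → Q → Set r) → Set (d ⊔ suc ℓ ⊔ r)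
  IsDataSimulation R =
    ∀ q ν q' → R q ν q' →
      (F q → F q') ×
      (∀ σ r ν' → Step q ν σ r ν' → ∃ λ r' → Step q' ν σ r' ν' × R r ν' r')

module Submission where

-- The invariant is
-- that the current states q and q' are related by R at the current valuation
-- (the first valuation of the remaining trace).
--   * Empty remainder: q is final, so q' is final by clause (1).
--   * A step (q, ν) --σ--> (q₁, ν₁): clause (2) yields a matching step
--     (q', ν) --σ--> (r', ν₁) with (q₁, ν₁, r') ∈ R, which re-establishes the
--     invariant for the rest of the run.

open import Defs
open import Relation.Unary using (_⊆_)
open import Data.List using (List; []; _∷_)
open import Data.Product using (_×_; _,_; proj₁; proj₂)
open import Relation.Binary.PropositionalEquality using (refl)

module _ {d ℓ r} {D : Set d} (A : DataAutomaton D ℓ)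
         (R : Q A → Val A → Q A → Set r) (isSim : IsDataSimulation A R) where

  simulationPreservesAcceptance :
    ∀ q q' (steps : List (Val A × Σ' A)) (νn : Val A) →
    R q (firstVal A (trace steps νn)) q' →
    AccRun A q steps νn → AccRun A q' steps νn
  simulationPreservesAcceptance q q' [] νn qRq' (done qFinal) =
    done (proj₁ (isSim q νn q' qRq') qFinal)
  simulationPreservesAcceptance q q' ((ν , σ) ∷ rest) νn qRq'
                                (step {q₁ = q₁} qStep run)
    with proj₂ (isSim q ν q' qRq') σ q₁ _ qStep
  ... | r' , q'Step , q₁Rr' =
    step q'Step (simulationPreservesAcceptance q₁ r' rest νn q₁Rr' run)

lemma9 : ∀ {d ℓ r} {D : Set d} (A : DataAutomaton D ℓ)
           (R : Q A → Val A → Q A → Set r) →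
           IsDataSimulation A R →
           ∀ q ν q' → R q ν q' → L A q ν ⊆ L A q' ν
lemma9 A R isSim q ν q' qRq' {trace steps νn} (refl , run) =
  refl , simulationPreservesAcceptance A R isSim q q' steps νn qRq' run
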